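{- Let $M$ and $K$ be finite disjoint sets with $|M|=m$, $P$ a poset on $K$, and $Q$ a partial order on $M\cup K$ inducing $P$ on $K$ whose set of minimal elements is exactly $M$. Define $p_Q(z)=\sum_{D\in\mathcal{D}(P)} z^{|M\setminus QD|}=\sum_{i=0}^m p_{Q,i}z^i$, where $p_{Q,i}=|\{D\in\mathcal{D}(P)\mid |M\setminus QD|=i\}|$; in particular $p_{Q,0}=|\{D\in\mathcal{D}(P)\mid M\subseteq QD\}|$. Then $p_Q$ is a monic polynomial of degree $m$ with $p_Q(1)=d(P)$ and $p_Q(2)=d(Q)$. Specifically: if $m=1$, $p_Q(z)=z+d(P)-1$; if $m=2$, $p_Q(z)=z^2+(d(Q)-d(P)-3)z-d(Q)+2d(P)+2$; if $m=3$, $p_Q(z)=z^3+\bigl(\tfrac12 d(Q)-d(P)+\tfrac12 p_{Q,0}-3\bigr)z^2-\bigl(\tfrac12 d(Q)-2d(P)+\tfrac32 p_{Q,0}-2\bigr)z+p_{Q,0}$.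
   Context: $\mathcal{D}(P)$ is the set of downsets of $P$, $d(\cdot)$ the number of downsets of a finite poset. For $D\subseteq K$, $QD=\{x\in M\cup K\mid x\le_Q y \text{ for some } y\in D\}$ is the down-closure of $D$ in $Q$. -}

module Defs where

open import Level using (0ℓ)
open import Data.Nat using (ℕ; zero; suc; _≟_)
open import Data.Fin using (Fin)
open import Data.Fin.Subset using (Subset; _∈_; inside; outside)
open import Data.Fin.Subset.Properties using (_∈?_)
open import Data.Fin.Properties using (all?; any?)
open import Data.Vec using ([]; _∷_)
open import Data.List using (List; []; _∷_; map; _++_; filter; length; allFin; cartesianProduct; foldr)
open import Data.Sum using (_⊎_; inj₁; inj₂)
open import Data.Product using (_×_; _,_; ∃; Σ)
open import Relation.Binary using (Rel; Decidable)
open import Relation.Nullary using (Dec; ¬_)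
open import Relation.Nullary.Decidable using (_→-dec_; _×-dec_; ¬?)
open import Relation.Binary.PropositionalEquality using (_≡_)
open import Data.Integer as ℤ using (ℤ)

allSubsets : ∀ n → List (Subset n)
allSubsets zero = [] ∷ []
allSubsets (suc n) = map (inside ∷_) (allSubsets n) ++ map (outside ∷_) (allSubsets n)

countFin : ∀ {n} {A : Fin n → Set} → ((x : Fin n) → Dec (A x)) → ℕ
countFin {n} A? = length (filter A? (allFin n))

IsDownset : ∀ {n} → Rel (Fin n) 0ℓ → Subset n → Set
IsDownset R S = ∀ x y → R x y → y ∈ S → x ∈ S

isDownset? : ∀ {n} {R : Rel (Fin n) 0ℓ} → Decidable R → (S : Subset n) → Dec (IsDownset R S)
isDownset? R? S = all? λ x → all? λ y → R? x y →-dec ((y ∈? S) →-dec (x ∈? S))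

downsets : ∀ {n} {R : Rel (Fin n) 0ℓ} → Decidable R → List (Subset n)
downsets {n} R? = filter (isDownset? R?) (allSubsets n)

d : ∀ {n} {R : Rel (Fin n) 0ℓ} → Decidable R → ℕ
d R? = length (downsets R?)

-- Relations on the disjoint union M ∪ K, with M = Fin m, K = Fin k.
-- A subset of M ∪ K is a pair (A , B), A ⊆ M, B ⊆ K.
_∈⊎_ : ∀ {m k} → Fin m ⊎ Fin k → Subset m × Subset k → Set
inj₁ i ∈⊎ (A , B) = i ∈ A
inj₂ j ∈⊎ (A , B) = j ∈ B

_∈⊎?_ : ∀ {m k} (x : Fin m ⊎ Fin k) (S : Subset m × Subset k) → Dec (x ∈⊎ S)
inj₁ i ∈⊎? (A , B) = i ∈? A
inj₂ j ∈⊎? (A , B) = j ∈? B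

all⊎? : ∀ {m k} {A : Fin m ⊎ Fin k → Set} → ((x : Fin m ⊎ Fin k) → Dec (A x))
        → Dec ((x : Fin m ⊎ Fin k) → A x)
all⊎? {A = A} A? with all? (λ i → A? (inj₁ i)) | all? (λ j → A? (inj₂ j))
... | Relation.Nullary.yes f | Relation.Nullary.yes g = Relation.Nullary.yes λ { (inj₁ i) → f i ; (inj₂ j) → g j }
... | Relation.Nullary.no ¬f | _ = Relation.Nullary.no λ h → ¬f (λ i → h (inj₁ i))
... | Relation.Nullary.yes _ | Relation.Nullary.no ¬g = Relation.Nullary.no λ h → ¬g (λ j → h (inj₂ j))

IsDownset⊎ : ∀ {m k} → Rel (Fin m ⊎ Fin k) 0ℓ → Subset m × Subset k → Set
IsDownset⊎ Q S = ∀ x y → Q x y → y ∈⊎ S → x ∈⊎ S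

isDownset⊎? : ∀ {m k} {Q : Rel (Fin m ⊎ Fin k) 0ℓ} → Decidable Q
              → (S : Subset m × Subset k) → Dec (IsDownset⊎ Q S)
isDownset⊎? Q? S = all⊎? λ x → all⊎? λ y → Q? x y →-dec ((y ∈⊎? S) →-dec (x ∈⊎? S))

d⊎ : ∀ {m k} {Q : Rel (Fin m ⊎ Fin k) 0ℓ} → Decidable Q → ℕ
d⊎ {m} {k} Q? = length (filter (isDownset⊎? Q?) (cartesianProduct (allSubsets m) (allSubsets k)))

IsMinimal : ∀ {A : Set} → Rel A 0ℓ → A → Set
IsMinimal {A} Q x = ∀ (y : A) → Q y x → y ≡ x

-- i ∈ M lies in QD (the down-closure of D ⊆ K in Q)
InQD : ∀ {m k} → Rel (Fin m ⊎ Fin k) 0ℓ → Subset k → Fin m → Set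
InQD Q D i = ∃ λ y → y ∈ D × Q (inj₁ i) (inj₂ y)

inQD? : ∀ {m k} {Q : Rel (Fin m ⊎ Fin k) 0ℓ} → Decidable Q → (D : Subset k) → (i : Fin m) → Dec (InQD Q D i)
inQD? Q? D i = any? λ y → (y ∈? D) ×-dec Q? (inj₁ i) (inj₂ y)

missing : ∀ {m k} {Q : Rel (Fin m ⊎ Fin k) 0ℓ} → Decidable Q → Subset k → ℕ
missing Q? D = countFin (λ i → ¬? (inQD? Q? D i))

pQ : ∀ {m k} {P : Rel (Fin k) 0ℓ} {Q : Rel (Fin m ⊎ Fin k) 0ℓ}
     → Decidable P → Decidable Q → ℤ → ℤ
pQ P? Q? z = foldr ℤ._+_ (ℤ.+ 0) (map (λ D → z ℤ.^ missing Q? D) (downsets P?))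

pQcoef : ∀ {m k} {P : Rel (Fin k) 0ℓ} {Q : Rel (Fin m ⊎ Fin k) 0ℓ}
         → Decidable P → Decidable Q → ℕ → ℕ
pQcoef P? Q? i = length (filter (λ D → missing Q? D ≟ i) (downsets P?))

polyEval : (ℕ → ℕ) → ℕ → ℤ → ℤ
polyEval c zero z = ℤ.+ c 0
polyEval c (suc n) z = polyEval c n z ℤ.+ (ℤ.+ c (suc n)) ℤ.* (z ℤ.^ suc n)

-- Every element of K lies above a minimal element of Q, i.e. above an element of M,
-- so |M ∖ QD| = m only for D = ∅: the polynomial is monic of degree m. A downset of Q is a pair
-- (A, D) with D a downset of P and QD ∩ M ⊆ A ⊆ M; each D admits 2^|M ∖ QD| such A, so
-- p_Q(2) = d(Q). For m ≤ 3 the explicit forms follow by interpolating a monic polynomial from its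
-- values at 1 and 2 (and its constant term p_{Q,0} when m = 3).

module Submission where

open import Defs
open import Level using (0ℓ)
open import Function.Base using (_∘_)
open import Function.Bundles using (_⇔_; mk⇔; Equivalence)
open import Data.Nat using (ℕ; zero; suc; _<_; _≤_; z≤n; _≟_)
import Data.Nat.Base as Nat
import Data.Nat.Properties as ℕₚ
open import Data.Nat.ListAction using (sum)
open import Data.Nat.ListAction.Properties using (sum-++)
open import Algebra.Properties.CommutativeSemigroup ℕₚ.+-commutativeSemigroup using (interchange)
open import Data.Fin as Fin using (Fin)
open import Data.Fin.Subset using (Subset; _∈_; inside; outside; Empty)
open import Data.Fin.Subset.Properties using (_∈?_; nonempty?; drop-there; drop-∷-Empty)
open import Data.Fin.Properties using (all?)
open import Data.Vec.Base using ([]; _∷_; here; there)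
open import Data.List using (List; []; _∷_; map; _++_; filter; length; tabulate; allFin; cartesianProduct; foldr)
import Data.List.Properties as List
open import Data.List.Relation.Unary.All as All using (All)
open import Data.List.Relation.Unary.Any as Any using (Any)
open import Data.List.Membership.Propositional using () renaming (_∈_ to _∈ₗ_)
open import Data.List.Membership.Propositional.Properties using (∈-allFin; ∈-map⁺; ∈-++⁺ˡ; ∈-++⁺ʳ)
open import Data.Sum using (_⊎_; inj₁; inj₂)
open import Data.Sum.Properties using (inj₁-injective)
open import Data.Product using (_×_; ∃; _,_; proj₂)
open import Relation.Binary using (Rel; Decidable; IsPartialOrder)
open import Relation.Nullary using (Dec; yes; no; ¬_; contradiction)
open import Relation.Nullary.Decidable using (_→-dec_; _×-dec_; ¬?)
open import Relation.Binary.PropositionalEquality using (_≡_; refl; sym; trans; cong; cong₂; subst; module ≡-Reasoning)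

private
  variable
    X Y : Set
    m n k : ℕ

module Counting where
  open Nat using (_+_; _*_; _^_)

  indicator : {P : Set} → Dec P → ℕ
  indicator (yes _) = 1
  indicator (no _) = 0

  indicator-true : {P : Set} (P? : Dec P) → P → indicator P? ≡ 1
  indicator-true (yes _) _ = refl
  indicator-true (no ¬p) p = contradiction p ¬p

  indicator-false : {P : Set} (P? : Dec P) → ¬ P → indicator P? ≡ 0
  indicator-false (yes p) ¬p = contradiction p ¬p
  indicator-false (no _) _ = refl

  indicator-cong : {P R : Set} (P? : Dec P) (R? : Dec R) → P ⇔ R → indicator P? ≡ indicator R?
  indicator-cong (yes p) R? P⇔R = sym (indicator-true R? (Equivalence.to P⇔R p))
  indicator-cong (no ¬p) R? P⇔R = sym (indicator-false R? (¬p ∘ Equivalence.from P⇔R))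

  indicator-× : {P R : Set} (P? : Dec P) (R? : Dec R) → indicator (P? ×-dec R?) ≡ indicator P? * indicator R?
  indicator-× (yes _) (yes _) = refl
  indicator-× (yes _) (no _) = refl
  indicator-× (no _) _ = refl

  ∑ : List X → (X → ℕ) → ℕ
  ∑ xs f = sum (map f xs)

  syntax ∑ xs (λ x → e) = ∑[ x ∈ xs ] e

  ∑-++ : ∀ xs ys (f : X → ℕ) → ∑ (xs ++ ys) f ≡ ∑ xs f + ∑ ys f
  ∑-++ xs ys f = trans (cong sum (List.map-++ f xs ys)) (sum-++ (map f xs) (map f ys))

  ∑-map : ∀ (g : X → Y) xs (f : Y → ℕ) → ∑ (map g xs) f ≡ ∑ xs (f ∘ g)
  ∑-map g xs f = cong sum (sym (List.map-∘ xs))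

  ∑-cong : ∀ (xs : List X) {f g : X → ℕ} → (∀ x → f x ≡ g x) → ∑ xs f ≡ ∑ xs g
  ∑-cong xs f≗g = cong sum (List.map-cong f≗g xs)

  ∑-zero : ∀ (xs : List X) → ∑[ x ∈ xs ] 0 ≡ 0
  ∑-zero [] = refl
  ∑-zero (x ∷ xs) = ∑-zero xs

  ∑-one : ∀ (xs : List X) → ∑[ x ∈ xs ] 1 ≡ length xs
  ∑-one [] = refl
  ∑-one (x ∷ xs) = cong suc (∑-one xs)

  ∑-+ : ∀ xs (f g : X → ℕ) → ∑[ x ∈ xs ] (f x + g x) ≡ ∑ xs f + ∑ xs g
  ∑-+ [] f g = refl
  ∑-+ (x ∷ xs) f g = trans (cong ((f x + g x) +_) (∑-+ xs f g)) (interchange (f x) (g x) (∑ xs f) (∑ xs g))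

  ∑-*ˡ : ∀ xs a (f : X → ℕ) → ∑[ x ∈ xs ] (a * f x) ≡ a * ∑ xs f
  ∑-*ˡ [] a f = sym (ℕₚ.*-zeroʳ a)
  ∑-*ˡ (x ∷ xs) a f = trans (cong (a * f x +_) (∑-*ˡ xs a f)) (sym (ℕₚ.*-distribˡ-+ a (f x) (∑ xs f)))

  ∑-comm : ∀ (xs : List X) (ys : List Y) (h : X → Y → ℕ) →
           ∑[ x ∈ xs ] ∑[ y ∈ ys ] h x y ≡ ∑[ y ∈ ys ] ∑[ x ∈ xs ] h x y
  ∑-comm [] ys h = sym (∑-zero ys)
  ∑-comm (x ∷ xs) ys h =
    trans (cong (∑ ys (h x) +_) (∑-comm xs ys h)) (sym (∑-+ ys (h x) (λ y → ∑[ x ∈ xs ] h x y)))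

  ∑-cartesianProduct : ∀ (xs : List X) (ys : List Y) (f : X × Y → ℕ) →
                       ∑ (cartesianProduct xs ys) f ≡ ∑[ x ∈ xs ] ∑[ y ∈ ys ] f (x , y)
  ∑-cartesianProduct [] ys f = refl
  ∑-cartesianProduct (x ∷ xs) ys f =
    trans (∑-++ (map (x ,_) ys) _ f) (cong₂ _+_ (∑-map (x ,_) ys f) (∑-cartesianProduct xs ys f))

  length-filter-∷ : ∀ {P : X → Set} (P? : ∀ x → Dec (P x)) x xs →
                    length (filter P? (x ∷ xs)) ≡ indicator (P? x) + length (filter P? xs)
  length-filter-∷ P? x xs with P? x
  ... | yes _ = refl
  ... | no _ = refl

  length-filter≡∑ : ∀ {P : X → Set} (P? : ∀ x → Dec (P x)) xs →
                    length (filter P? xs) ≡ ∑ xs (indicator ∘ P?)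
  length-filter≡∑ P? [] = refl
  length-filter≡∑ P? (x ∷ xs) =
    trans (length-filter-∷ P? x xs) (cong (indicator (P? x) +_) (length-filter≡∑ P? xs))

  ∑-filter : ∀ {P : X → Set} (P? : ∀ x → Dec (P x)) xs (f : X → ℕ) →
             ∑ (filter P? xs) f ≡ ∑[ x ∈ xs ] (indicator (P? x) * f x)
  ∑-filter P? [] f = refl
  ∑-filter P? (x ∷ xs) f with P? x
  ... | yes _ = cong₂ _+_ (sym (ℕₚ.+-identityʳ (f x))) (∑-filter P? xs f)
  ... | no _ = ∑-filter P? xs f

  length-allFin : ∀ n → length (allFin n) ≡ n
  length-allFin n = List.length-tabulate (λ i → i)

  countFin≤ : ∀ {P : Fin n → Set} (P? : ∀ i → Dec (P i)) → countFin P? ≤ n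
  countFin≤ {n} P? = subst (countFin P? ≤_) (length-allFin n) (List.length-filter P? (allFin n))

  countFin≡n⇔all : ∀ {P : Fin n → Set} (P? : ∀ i → Dec (P i)) → countFin P? ≡ n ⇔ (∀ i → P i)
  countFin≡n⇔all {n} {P} P? = mk⇔ all-kept all-counted
    where
    all-kept : countFin P? ≡ n → ∀ i → P i
    all-kept count≡n i with P? i
    ... | yes p = p
    ... | no ¬p = contradiction (trans count≡n (sym (length-allFin n)))
                    (ℕₚ.<⇒≢ (List.filter-notAll P? (allFin n) (Any.map (λ { refl → ¬p }) (∈-allFin i))))

    all-counted : (∀ i → P i) → countFin P? ≡ n
    all-counted all-P =
      trans (cong length (List.filter-all P? {xs = allFin n} (All.tabulate (λ {i} _ → all-P i)))) (length-allFin n)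

  ∑-allFin-suc : ∀ (f : Fin (suc n) → ℕ) →
                 ∑ (allFin (suc n)) f ≡ f Fin.zero + ∑ (allFin n) (f ∘ Fin.suc)
  ∑-allFin-suc {n} f = cong (f Fin.zero +_) (begin
    ∑ (tabulate Fin.suc) f           ≡⟨ cong (λ xs → ∑ xs f) (List.map-tabulate (λ i → i) Fin.suc) ⟨
    ∑ (map Fin.suc (allFin n)) f     ≡⟨ ∑-map Fin.suc (allFin n) f ⟩
    ∑ (allFin n) (f ∘ Fin.suc)       ∎)
    where open ≡-Reasoning

  countFin-suc : ∀ {P : Fin (suc n) → Set} (P? : ∀ i → Dec (P i)) →
                 countFin P? ≡ indicator (P? Fin.zero) + countFin (P? ∘ Fin.suc)
  countFin-suc {n} P? = begin
    countFin P?
      ≡⟨ length-filter≡∑ P? (allFin (suc n)) ⟩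
    ∑ (allFin (suc n)) (indicator ∘ P?)
      ≡⟨ ∑-allFin-suc (indicator ∘ P?) ⟩
    indicator (P? Fin.zero) + ∑ (allFin n) (indicator ∘ P? ∘ Fin.suc)
      ≡⟨ cong (indicator (P? Fin.zero) +_) (length-filter≡∑ (P? ∘ Fin.suc) (allFin n)) ⟨
    indicator (P? Fin.zero) + countFin (P? ∘ Fin.suc)
      ∎
    where open ≡-Reasoning

  ∑-allSubsets-suc : ∀ (f : Subset (suc n) → ℕ) →
    ∑ (allSubsets (suc n)) f
      ≡ ∑[ A ∈ allSubsets n ] f (inside ∷ A) + ∑[ A ∈ allSubsets n ] f (outside ∷ A)
  ∑-allSubsets-suc {n} f = trans (∑-++ (map (inside ∷_) (allSubsets n)) _ f)
    (cong₂ _+_ (∑-map (inside ∷_) (allSubsets n) f) (∑-map (outside ∷_) (allSubsets n) f))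

  _⊇ₚ_ : Subset n → (Fin n → Set) → Set
  A ⊇ₚ p = ∀ i → p i → i ∈ A

  _⊇ₚ?_ : (A : Subset n) {p : Fin n → Set} → (∀ i → Dec (p i)) → Dec (A ⊇ₚ p)
  A ⊇ₚ? p? = all? λ i → p? i →-dec (i ∈? A)

  inside∷-⊇ₚ⇔ : {A : Subset n} {p : Fin (suc n) → Set} →
                (inside ∷ A) ⊇ₚ p ⇔ A ⊇ₚ (p ∘ Fin.suc)
  inside∷-⊇ₚ⇔ = mk⇔ (λ A⊇p i pᵢ → drop-there (A⊇p (Fin.suc i) pᵢ))
                     (λ { A⊇p Fin.zero _ → here ; A⊇p (Fin.suc i) pᵢ → there (A⊇p i pᵢ) })

  outside∷-⊇ₚ⇔ : {A : Subset n} {p : Fin (suc n) → Set} →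
                 (outside ∷ A) ⊇ₚ p ⇔ (¬ p Fin.zero × A ⊇ₚ (p ∘ Fin.suc))
  outside∷-⊇ₚ⇔ = mk⇔
    (λ A⊇p → (λ p₀ → zero∉ (A⊇p Fin.zero p₀)) , (λ i pᵢ → drop-there (A⊇p (Fin.suc i) pᵢ)))
    (λ { (¬p₀ , _) Fin.zero p₀ → contradiction p₀ ¬p₀
       ; (_ , A⊇p) (Fin.suc i) pᵢ → there (A⊇p i pᵢ) })
    where
    zero∉ : ∀ {A : Subset n} → ¬ Fin.zero ∈ (outside ∷ A)
    zero∉ ()

  supersets-count : ∀ n {p : Fin n → Set} (p? : ∀ i → Dec (p i)) →
                    ∑[ A ∈ allSubsets n ] indicator (A ⊇ₚ? p?) ≡ 2 ^ countFin (¬? ∘ p?)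
  supersets-count zero p? = cong (_+ 0) (indicator-true ([] ⊇ₚ? p?) (λ ()))
  supersets-count (suc n) {p} p? = begin
    ∑[ A ∈ allSubsets (suc n) ] indicator (A ⊇ₚ? p?)
      ≡⟨ ∑-allSubsets-suc (λ A → indicator (A ⊇ₚ? p?)) ⟩
    ∑[ A ∈ allSubsets n ] indicator ((inside ∷ A) ⊇ₚ? p?)
      + ∑[ A ∈ allSubsets n ] indicator ((outside ∷ A) ⊇ₚ? p?)
      ≡⟨ cong₂ _+_ (∑-cong (allSubsets n) (λ A → indicator-cong _ (A ⊇ₚ? p?′) inside∷-⊇ₚ⇔))
                   (∑-cong (allSubsets n) (λ A →
                      trans (indicator-cong _ (¬p₀? ×-dec (A ⊇ₚ? p?′)) outside∷-⊇ₚ⇔) (indicator-× ¬p₀? (A ⊇ₚ? p?′)))) ⟩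
    ∑[ A ∈ allSubsets n ] indicator (A ⊇ₚ? p?′)
      + ∑[ A ∈ allSubsets n ] (indicator ¬p₀? * indicator (A ⊇ₚ? p?′))
      ≡⟨ cong₂ _+_ (supersets-count n p?′)
                   (trans (∑-*ˡ (allSubsets n) (indicator ¬p₀?) _)
                          (cong (indicator ¬p₀? *_) (supersets-count n p?′))) ⟩
    2 ^ countFin (¬? ∘ p?′) + indicator ¬p₀? * 2 ^ countFin (¬? ∘ p?′)
      ≡⟨ doubles-if ¬p₀? ⟩
    2 ^ (indicator ¬p₀? + countFin (¬? ∘ p?′))
      ≡⟨ cong (2 ^_) (countFin-suc (¬? ∘ p?)) ⟨
    2 ^ countFin (¬? ∘ p?)
      ∎
    where
    open ≡-Reasoning
    p?′ : ∀ i → Dec (p (Fin.suc i))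
    p?′ = p? ∘ Fin.suc

    ¬p₀? : Dec (¬ p Fin.zero)
    ¬p₀? = ¬? (p? Fin.zero)

    doubles-if : ∀ {R : Set} (R? : Dec R) {c} → 2 ^ c + indicator R? * 2 ^ c ≡ 2 ^ (indicator R? + c)
    doubles-if (yes _) = refl
    doubles-if (no _) = ℕₚ.+-identityʳ _

  empty? : (D : Subset n) → Dec (Empty D)
  empty? D = ¬? (nonempty? D)

  empty-count : ∀ n → ∑[ D ∈ allSubsets n ] indicator (empty? D) ≡ 1
  empty-count zero = cong (_+ 0) (indicator-true (empty? []) λ { (() , _) })
  empty-count (suc n) = trans (∑-allSubsets-suc {n} (indicator ∘ empty?)) (cong₂ _+_
    (trans (∑-cong (allSubsets n) (λ D → indicator-false (empty? (inside ∷ D)) (λ e → e (Fin.zero , here))))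
           (∑-zero (allSubsets n)))
    (trans (∑-cong (allSubsets n) (λ D → indicator-cong (empty? (outside ∷ D)) (empty? D)
              (mk⇔ drop-∷-Empty (λ e → λ { (Fin.zero , ()) ; (Fin.suc i , there i∈D) → e (i , i∈D) }))))
           (empty-count n)))

open Counting

open import Data.Integer.Base using (ℤ; +_; _+_; _-_; _*_; _^_)
import Data.Integer.Properties as ℤₚ
open import Data.Integer.Solver using (module +-*-Solver)

pos-^ : ∀ a n → (+ a) ^ n ≡ + (a Nat.^ n)
pos-^ a zero = refl
pos-^ a (suc n) = trans (cong (+ a *_) (pos-^ a n)) (sym (ℤₚ.pos-* a (a Nat.^ n)))

polyEval-cong : ∀ n {a b : ℕ → ℕ} z → (∀ i → a i ≡ b i) → polyEval a n z ≡ polyEval b n z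
polyEval-cong zero z a≗b = cong +_ (a≗b 0)
polyEval-cong (suc n) z a≗b = cong₂ (λ u v → u + + v * z ^ suc n) (polyEval-cong n z a≗b) (a≗b (suc n))

polyEval-+ : ∀ n (a b : ℕ → ℕ) z → polyEval (λ i → a i Nat.+ b i) n z ≡ polyEval a n z + polyEval b n z
polyEval-+ zero a b z = ℤₚ.pos-+ (a 0) (b 0)
polyEval-+ (suc n) a b z =
  trans (cong₂ (λ u v → u + v * z ^ suc n) (polyEval-+ n a b z) (ℤₚ.pos-+ (a (suc n)) (b (suc n))))
        (interchange-linear (polyEval a n z) (polyEval b n z) (+ a (suc n)) (+ b (suc n)) (z ^ suc n))
  where
  open +-*-Solver
  interchange-linear : ∀ u v α β w → (u + v) + (α + β) * w ≡ (u + α * w) + (v + β * w)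
  interchange-linear = solve 5 (λ u v α β w → (u :+ v) :+ (α :+ β) :* w := (u :+ α :* w) :+ (v :+ β :* w)) refl

polyEval-vanishing : ∀ n {c : ℕ → ℕ} z → (∀ i → i ≤ n → c i ≡ 0) → polyEval c n z ≡ + 0
polyEval-vanishing zero z c≡0 = cong +_ (c≡0 0 z≤n)
polyEval-vanishing (suc n) z c≡0 = cong₂ (λ u v → u + + v * z ^ suc n)
  (polyEval-vanishing n z (λ i i≤n → c≡0 i (ℕₚ.m≤n⇒m≤1+n i≤n))) (c≡0 (suc n) ℕₚ.≤-refl)

monomial : ℕ → ℕ → ℕ
monomial j i = indicator (j ≟ i)

polyEval-monomial : ∀ {j} n z → j ≤ n → polyEval (monomial j) n z ≡ z ^ j
polyEval-monomial zero z z≤n = refl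
polyEval-monomial {j} (suc n) z j≤1+n with ℕₚ.m≤n⇒m<n∨m≡n j≤1+n
... | inj₁ j<1+n = trans
  (cong₂ (λ u v → u + + v * z ^ suc n) (polyEval-monomial n z (ℕₚ.≤-pred j<1+n))
         (indicator-false (j ≟ suc n) (ℕₚ.<⇒≢ j<1+n)))
  (ℤₚ.+-identityʳ (z ^ j))
... | inj₂ refl = trans
  (cong₂ (λ u v → u + + v * z ^ suc n)
         (polyEval-vanishing n z (λ i i≤n → indicator-false (suc n ≟ i) (ℕₚ.>⇒≢ (Nat.s≤s i≤n))))
         (indicator-true (suc n ≟ suc n) refl))
  (trans (ℤₚ.+-identityˡ _) (ℤₚ.*-identityˡ _))

powerSum : ℤ → (X → ℕ) → List X → ℤ
powerSum z f xs = foldr _+_ (+ 0) (map (λ x → z ^ f x) xs)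

powerSum≡polyEval : ∀ n z (f : X → ℕ) xs → (∀ x → f x ≤ n) →
                    powerSum z f xs ≡ polyEval (λ i → length (filter (λ x → f x ≟ i) xs)) n z
powerSum≡polyEval n z f [] f≤n = sym (polyEval-vanishing n z (λ _ _ → refl))
powerSum≡polyEval n z f (x ∷ xs) f≤n = begin
  z ^ f x + powerSum z f xs
    ≡⟨ cong₂ _+_ (sym (polyEval-monomial n z (f≤n x))) (powerSum≡polyEval n z f xs f≤n) ⟩
  polyEval (monomial (f x)) n z + polyEval (count xs) n z
    ≡⟨ polyEval-+ n (monomial (f x)) (count xs) z ⟨
  polyEval (λ i → monomial (f x) i Nat.+ count xs i) n z
    ≡⟨ polyEval-cong n z (λ i → length-filter-∷ (λ y → f y ≟ i) x xs) ⟨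
  polyEval (count (x ∷ xs)) n z ∎
  where
  open ≡-Reasoning
  count : List _ → ℕ → ℕ
  count ys i = length (filter (λ y → f y ≟ i) ys)

powerSum-pos : ∀ a (f : X → ℕ) xs → powerSum (+ a) f xs ≡ + ∑[ x ∈ xs ] (a Nat.^ f x)
powerSum-pos a f [] = refl
powerSum-pos a f (x ∷ xs) =
  trans (cong₂ _+_ (pos-^ a (f x)) (powerSum-pos a f xs)) (sym (ℤₚ.pos-+ (a Nat.^ f x) _))

module _ {p : ℤ → ℤ} (c : ℕ → ℕ) where
  open +-*-Solver

  monic-linear : (∀ z → p z ≡ polyEval c 1 z) → c 1 ≡ 1 → ∀ {v₁} → p (+ 1) ≡ v₁ →
                 ∀ z → p z ≡ z + v₁ - + 1
  monic-linear p≡ c₁≡1 refl z rewrite p≡ z | p≡ (+ 1) | c₁≡1 = solve 2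
    (λ a w → let q = λ x → a :+ con (+ 1) :* x :^ 1 in
       q w := w :+ q (con (+ 1)) :- con (+ 1))
    refl (+ c 0) z

  monic-quadratic : (∀ z → p z ≡ polyEval c 2 z) → c 2 ≡ 1 →
                    ∀ {v₁ v₂} → p (+ 1) ≡ v₁ → p (+ 2) ≡ v₂ →
                    ∀ z → p z ≡ z ^ 2 + (v₂ - v₁ - + 3) * z - v₂ + + 2 * v₁ + + 2
  monic-quadratic p≡ c₂≡1 refl refl z rewrite p≡ z | p≡ (+ 1) | p≡ (+ 2) | c₂≡1 = solve 3
    (λ a b w → let q = λ x → a :+ b :* x :^ 1 :+ con (+ 1) :* x :^ 2 in
       q w := w :^ 2 :+ (q (con (+ 2)) :- q (con (+ 1)) :- con (+ 3)) :* w
              :- q (con (+ 2)) :+ con (+ 2) :* q (con (+ 1)) :+ con (+ 2))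
    refl (+ c 0) (+ c 1) z

  monic-cubic : (∀ z → p z ≡ polyEval c 3 z) → c 3 ≡ 1 →
                ∀ {v₁ v₂} → p (+ 1) ≡ v₁ → p (+ 2) ≡ v₂ →
                ∀ z → + 2 * p z ≡ + 2 * z ^ 3
                                  + (v₂ - + 2 * v₁ + + c 0 - + 6) * z ^ 2
                                  - (v₂ - + 4 * v₁ + + 3 * + c 0 - + 4) * z
                                  + + 2 * + c 0
  monic-cubic p≡ c₃≡1 refl refl z rewrite p≡ z | p≡ (+ 1) | p≡ (+ 2) | c₃≡1 = solve 4
    (λ a b e w → let q = λ x → a :+ b :* x :^ 1 :+ e :* x :^ 2 :+ con (+ 1) :* x :^ 3 in
       con (+ 2) :* q w := con (+ 2) :* w :^ 3
                           :+ (q (con (+ 2)) :- con (+ 2) :* q (con (+ 1)) :+ a :- con (+ 6)) :* w :^ 2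
                           :- (q (con (+ 2)) :- con (+ 4) :* q (con (+ 1)) :+ con (+ 3) :* a :- con (+ 4)) :* w
                           :+ con (+ 2) :* a)
    refl (+ c 0) (+ c 1) (+ c 2) z

module _ {X : Set} {_≼_ : Rel X 0ℓ} (_≼?_ : Decidable _≼_) (≼-po : IsPartialOrder _≡_ _≼_) where
  open IsPartialOrder ≼-po using (antisym) renaming (refl to ≼-refl; trans to ≼-trans)

  private
    lower : X → X → X
    lower x c with x ≼? c
    ... | yes _ = x
    ... | no _ = c

    lower-≼ : ∀ x c → lower x c ≼ c
    lower-≼ x c with x ≼? c
    ... | yes x≼c = x≼c
    ... | no _ = ≼-refl

    lower-≼ˡ : ∀ {x c} → x ≼ c → lower x c ≼ x
    lower-≼ˡ {x} {c} x≼c with x ≼? c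
    ... | yes _ = ≼-refl
    ... | no x⋠c = contradiction x≼c x⋠c

    descend : List X → X → X
    descend [] c = c
    descend (x ∷ xs) c = descend xs (lower x c)

    descend-≼ : ∀ xs c → descend xs c ≼ c
    descend-≼ [] c = ≼-refl
    descend-≼ (x ∷ xs) c = ≼-trans (descend-≼ xs (lower x c)) (lower-≼ x c)

    -- When y was scanned the candidate lay above y, so it was replaced by y.
    descend-minimal : ∀ {y} xs c → y ∈ₗ xs → y ≼ descend xs c → y ≡ descend xs c
    descend-minimal (x ∷ xs) c (Any.there y∈xs) y≼ = descend-minimal xs (lower x c) y∈xs y≼
    descend-minimal (x ∷ xs) c (Any.here refl) x≼ =
      antisym x≼ (≼-trans (descend-≼ xs (lower x c)) (lower-≼ˡ (≼-trans x≼ (descend-≼ (x ∷ xs) c))))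

  minimal-below : (xs : List X) → (∀ y → y ∈ₗ xs) → ∀ x → ∃ λ z → z ≼ x × IsMinimal _≼_ z
  minimal-below xs enum x = descend xs x , descend-≼ xs x , λ y y≼ → descend-minimal xs x (enum y) y≼

allFin⊎ : ∀ m k → List (Fin m ⊎ Fin k)
allFin⊎ m k = map inj₁ (allFin m) ++ map inj₂ (allFin k)

∈-allFin⊎ : ∀ (x : Fin m ⊎ Fin k) → x ∈ₗ allFin⊎ m k
∈-allFin⊎ (inj₁ i) = ∈-++⁺ˡ (∈-map⁺ inj₁ (∈-allFin i))
∈-allFin⊎ {m} (inj₂ j) = ∈-++⁺ʳ (map inj₁ (allFin m)) (∈-map⁺ inj₂ (∈-allFin j))

K-above-M : {Q : Rel (Fin m ⊎ Fin k) 0ℓ} → Decidable Q → IsPartialOrder _≡_ Q →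
            (∀ x → IsMinimal Q x → ∃ λ i → x ≡ inj₁ i) → ∀ y → ∃ λ i → Q (inj₁ i) (inj₂ y)
K-above-M Q? Q-po minimal⇒M y with minimal-below Q? Q-po (allFin⊎ _ _) ∈-allFin⊎ (inj₂ y)
... | x , x≼y , x-minimal with minimal⇒M x x-minimal
... | i , refl = i , x≼y

missing≡m⇔Empty : {Q : Rel (Fin m ⊎ Fin k) 0ℓ} (Q? : Decidable Q) →
                  (∀ y → ∃ λ i → Q (inj₁ i) (inj₂ y)) → ∀ D → missing Q? D ≡ m ⇔ Empty D
missing≡m⇔Empty Q? above D = mk⇔
  (λ missing≡m (y , y∈D) → let i , q = above y in to missing≡m i (y , y∈D , q))
  (λ empty → from (λ i (y , y∈D , _) → empty (y , y∈D)))
  where open Equivalence (countFin≡n⇔all (λ i → ¬? (inQD? Q? D i)))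

downset⊎⇔ : {P : Rel (Fin k) 0ℓ} {Q : Rel (Fin m ⊎ Fin k) 0ℓ} →
            (∀ x y → P x y ⇔ Q (inj₂ x) (inj₂ y)) → (∀ i → IsMinimal Q (inj₁ i)) →
            ∀ A B → IsDownset⊎ Q (A , B) ⇔ (IsDownset P B × A ⊇ₚ InQD Q B)
downset⊎⇔ {P = P} {Q} P⇔Q M-minimal A B = mk⇔ split join
  where
  split : IsDownset⊎ Q (A , B) → IsDownset P B × A ⊇ₚ InQD Q B
  split ds = (λ x y x≤y y∈B → ds (inj₂ x) (inj₂ y) (Equivalence.to (P⇔Q x y) x≤y) y∈B)
           , (λ { i (y , y∈B , i≤y) → ds (inj₁ i) (inj₂ y) i≤y y∈B })

  join : IsDownset P B × A ⊇ₚ InQD Q B → IsDownset⊎ Q (A , B)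
  join _ (inj₁ i) (inj₁ j) i≤j j∈A =
    subst (_∈ A) (inj₁-injective (sym (M-minimal j (inj₁ i) i≤j))) j∈A
  join _ (inj₂ x) (inj₁ j) x≤j _ with M-minimal j (inj₂ x) x≤j
  ... | ()
  join (_ , A⊇QB) (inj₁ i) (inj₂ y) i≤y y∈B = A⊇QB i (y , y∈B , i≤y)
  join (ds , _) (inj₂ x) (inj₂ y) x≤y y∈B = ds x y (Equivalence.from (P⇔Q x y) x≤y) y∈B

module _ {P : Rel (Fin k) 0ℓ} {Q : Rel (Fin m ⊎ Fin k) 0ℓ} (P? : Decidable P) (Q? : Decidable Q) where

  pQ≡polyEval : ∀ z → pQ P? Q? z ≡ polyEval (pQcoef P? Q?) m z
  pQ≡polyEval z = powerSum≡polyEval m z (missing Q?) (downsets P?) (λ D → countFin≤ _)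

  pQcoef-beyond : ∀ i → m < i → pQcoef P? Q? i ≡ 0
  pQcoef-beyond i m<i = cong length (List.filter-none (λ D → missing Q? D ≟ i) {xs = downsets P?}
    (All.tabulate (λ {D} _ missing≡i → ℕₚ.<⇒≢ (ℕₚ.≤-<-trans (countFin≤ _) m<i) missing≡i)))

  pQcoef-leading : (∀ y → ∃ λ i → Q (inj₁ i) (inj₂ y)) → pQcoef P? Q? m ≡ 1
  pQcoef-leading above = begin
    length (filter (λ D → missing Q? D ≟ m) (downsets P?))
      ≡⟨ length-filter≡∑ _ (downsets P?) ⟩
    ∑[ D ∈ downsets P? ] indicator (missing Q? D ≟ m)
      ≡⟨ ∑-filter (isDownset? P?) (allSubsets k) _ ⟩
    ∑[ D ∈ allSubsets k ] (indicator (isDownset? P? D) Nat.* indicator (missing Q? D ≟ m))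
      ≡⟨ ∑-cong (allSubsets k) (λ D → trans (sym (indicator-× (isDownset? P? D) (missing Q? D ≟ m)))
                                          (indicator-cong _ (empty? D) (top⇔empty D))) ⟩
    ∑[ D ∈ allSubsets k ] indicator (empty? D)
      ≡⟨ empty-count k ⟩
    1 ∎
    where
    open ≡-Reasoning
    top⇔empty : ∀ D → (IsDownset P D × missing Q? D ≡ m) ⇔ Empty D
    top⇔empty D = mk⇔ (to ∘ proj₂)
                      (λ empty → (λ _ y _ y∈D → contradiction (y , y∈D) empty) , from empty)
      where open Equivalence (missing≡m⇔Empty Q? above D)

  pQ-at-1 : pQ P? Q? (+ 1) ≡ + d P?
  pQ-at-1 = trans (powerSum-pos 1 (missing Q?) (downsets P?))
    (cong +_ (trans (∑-cong (downsets P?) (ℕₚ.^-zeroˡ ∘ missing Q?)) (∑-one (downsets P?))))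

  pQ-at-2 : (∀ x y → P x y ⇔ Q (inj₂ x) (inj₂ y)) → (∀ i → IsMinimal Q (inj₁ i)) →
            pQ P? Q? (+ 2) ≡ + d⊎ Q?
  pQ-at-2 P⇔Q M-minimal = trans (powerSum-pos 2 (missing Q?) (downsets P?)) (cong +_ (begin
    ∑[ B ∈ downsets P? ] (2 Nat.^ missing Q? B)
      ≡⟨ ∑-filter (isDownset? P?) Sk _ ⟩
    ∑[ B ∈ Sk ] (indicator (isDownset? P? B) Nat.* 2 Nat.^ missing Q? B)
      ≡⟨ ∑-cong Sk (λ B → cong (indicator (isDownset? P? B) Nat.*_) (supersets-count m (inQD? Q? B))) ⟨
    ∑[ B ∈ Sk ] (indicator (isDownset? P? B) Nat.* ∑[ A ∈ Sm ] indicator (A ⊇ₚ? inQD? Q? B))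
      ≡⟨ ∑-cong Sk (λ B → ∑-*ˡ Sm (indicator (isDownset? P? B)) _) ⟨
    ∑[ B ∈ Sk ] ∑[ A ∈ Sm ] (indicator (isDownset? P? B) Nat.* indicator (A ⊇ₚ? inQD? Q? B))
      ≡⟨ ∑-cong Sk (λ B → ∑-cong Sm (λ A →
           trans (sym (indicator-× (isDownset? P? B) (A ⊇ₚ? inQD? Q? B)))
                 (sym (indicator-cong (isDownset⊎? Q? (A , B)) _ (downset⊎⇔ P⇔Q M-minimal A B))))) ⟩
    ∑[ B ∈ Sk ] ∑[ A ∈ Sm ] indicator (isDownset⊎? Q? (A , B))
      ≡⟨ ∑-comm Sm Sk (λ A B → indicator (isDownset⊎? Q? (A , B))) ⟨
    ∑[ A ∈ Sm ] ∑[ B ∈ Sk ] indicator (isDownset⊎? Q? (A , B))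
      ≡⟨ ∑-cartesianProduct Sm Sk (indicator ∘ isDownset⊎? Q?) ⟨
    ∑ (cartesianProduct Sm Sk) (indicator ∘ isDownset⊎? Q?)
      ≡⟨ length-filter≡∑ (isDownset⊎? Q?) (cartesianProduct Sm Sk) ⟨
    d⊎ Q? ∎))
    where
    open ≡-Reasoning
    Sm : List (Subset m)
    Sm = allSubsets m

    Sk : List (Subset k)
    Sk = allSubsets k

lemma4p1 : (m k : ℕ) (P : Rel (Fin k) 0ℓ) (Q : Rel (Fin m ⊎ Fin k) 0ℓ)
           (P? : Decidable P) (Q? : Decidable Q)
           → IsPartialOrder _≡_ P
           → IsPartialOrder _≡_ Q
           → (∀ x y → P x y ⇔ Q (inj₂ x) (inj₂ y))
           → (∀ x → IsMinimal Q x ⇔ (∃ λ i → x ≡ inj₁ i))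
           → (∀ z → pQ P? Q? z ≡ polyEval (pQcoef P? Q?) m z)
             × pQcoef P? Q? m ≡ 1
             × (∀ i → m < i → pQcoef P? Q? i ≡ 0)
             × pQ P? Q? (+ 1) ≡ + d P?
             × pQ P? Q? (+ 2) ≡ + d⊎ Q?
             × (m ≡ 1 → ∀ z → pQ P? Q? z ≡ z + + d P? - + 1)
             × (m ≡ 2 → ∀ z → pQ P? Q? z
                  ≡ z ^ 2 + (+ d⊎ Q? - + d P? - + 3) * z - + d⊎ Q? + + 2 * + d P? + + 2)
             × (m ≡ 3 → ∀ z → + 2 * pQ P? Q? z
                  ≡ + 2 * z ^ 3
                    + (+ d⊎ Q? - + 2 * + d P? + + pQcoef P? Q? 0 - + 6) * z ^ 2
                    - (+ d⊎ Q? - + 4 * + d P? + + 3 * + pQcoef P? Q? 0 - + 4) * z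
                    + + 2 * + pQcoef P? Q? 0)
lemma4p1 m k P Q P? Q? _ Q-po P⇔Q minimal⇔M =
  expansion , leading , pQcoef-beyond P? Q? , pQ-at-1 P? Q? , value-2 ,
  (λ { refl → monic-linear (pQcoef P? Q?) expansion leading (pQ-at-1 P? Q?) }) ,
  (λ { refl → monic-quadratic (pQcoef P? Q?) expansion leading (pQ-at-1 P? Q?) value-2 }) ,
  (λ { refl → monic-cubic (pQcoef P? Q?) expansion leading (pQ-at-1 P? Q?) value-2 })
  where
  expansion : ∀ z → pQ P? Q? z ≡ polyEval (pQcoef P? Q?) m z
  expansion = pQ≡polyEval P? Q?

  leading : pQcoef P? Q? m ≡ 1
  leading = pQcoef-leading P? Q? (K-above-M Q? Q-po (Equivalence.to ∘ minimal⇔M))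

  value-2 : pQ P? Q? (+ 2) ≡ + d⊎ Q?
  value-2 = pQ-at-2 P? Q? P⇔Q (λ i → Equivalence.from (minimal⇔M (inj₁ i)) (i , refl))
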